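{- Let $\Sigma$ be a finite alphabet, $S=\langle (s_1,t_1),(s_2,t_2),\ldots\rangle$ a sequence of events arriving one after another with $s_i\in\Sigma$ and strictly increasing timestamps, $e=\langle\phi_1,\ldots,\phi_k\rangle$ a serial episode over $\Sigma$ and $\tau>0$. Then the ONCE algorithm (described in the context) correctly solves the time-constrained frequency counting problem: for every $n\ge1$, the value of its counter after processing the first $n$ events equals the non-overlapped frequency $freq(e^\tau,S(n))$.
   Context: An occurrence of $e$ in a sequence is a tuple $\langle x_1,\ldots,x_k\rangle$ of timestamps with $x_1<\cdots<x_k$ such that the event at timestamp $x_i$ is $\phi_i$; it is an occurrence of the time-constrained episode $e^\tau$ if moreover $x_k-x_1\le\tau$. Two occurrences $\langle x_1,\ldots,x_k\rangle$, $\langle x_1',\ldots,x_k'\rangle$ are non-overlapped if $x_1'>x_k$ or $x_1>x_k'$. The non-overlapped frequency $freq(e^\tau,S(n))$ is the maximum number of pairwise non-overlapped occurrences of $e^\tau$ in the prefix $S(n)$ consisting of the first $n$ events. ONCE algorithm: it keeps lists $L_1,\ldots,L_k$ of timestamps ($L_i$ corresponds to $\phi_i$; $L_i[1]$ denotes its first entry), an integer $\ell$ and a counter $c$; initially all lists are empty, $\ell=1$, $c=0$. For each arriving event $(s,t)$: (1) ListUpdate: for each $j\le\min(\ell,k)$ ($\ell$ as before this event) with $\phi_j=s$, append $t$ to the end of $L_j$, and then if $t-L_j[1]>\tau$ remove $L_j[1]$ from $L_j$; afterwards set $\ell$ to the smallest index of an empty list (or $k+1$ if none). (2) If $L_k$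 is non-empty, Validate&Eliminate: set $t_k=L_k[1]$ and for $i=k-1$ down to $1$ let $t_i$ be the largest entry of $L_i$ smaller than $t_{i+1}$. If $t_k-t_1\le\tau$: empty all lists, set $\ell=1$ and increase $c$ by $1$. Otherwise: for every $i$ remove from $L_i$ all entries $\le t_i$; then for $i=2,\ldots,k-1$ remove from $L_i$ all entries $\le L_{i-1}[1]$; then set $\ell=1+\max\{i: L_i\neq\emptyset\}$ ($\ell=1$ if all lists are empty). -}

module Defs where

open import Data.Nat using (ℕ; zero; suc; _+_; _∸_; _≤_; _<_; _<ᵇ_; _≤ᵇ_)
open import Data.Bool using (Bool; true; false; if_then_else_; _∧_; not)
open import Data.Fin as Fin using (Fin; toℕ; fromℕ)
open import Data.List as List using (List; []; _∷_; _++_; [_]; filter)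
open import Data.Maybe using (Maybe; just; nothing)
open import Data.Vec as Vec using (Vec; []; _∷_; lookup; tabulate; zipWith)
open import Data.Product using (_×_; _,_; proj₁; proj₂; ∃; Σ)
open import Data.Sum using (_⊎_)
open import Relation.Nullary using (does; ¬_)
open import Relation.Nullary.Decidable using (⌊_⌋)
open import Relation.Binary.PropositionalEquality using (_≡_; _≢_)

-- Conventions
--  * Alphabet Σ = Fin m (a finite alphabet).
--  * Timestamps are natural numbers.
--  * An event stream is S : ℕ → Fin m × ℕ ; S i is the (i+1)-st event
--    (s_{i+1} , t_{i+1}).  The prefix S(n) consists of S 0 … S (n-1).
--  * A serial episode e = ⟨φ_1,…,φ_k⟩ with k ≥ 1 is a Vec (Fin m) (suc k);
--    position j : Fin (suc k) stands for φ_{toℕ j + 1}.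

Event : ℕ → Set
Event m = Fin m × ℕ

StrictlyIncreasingTimes : ∀ {m} → (ℕ → Event m) → Set
StrictlyIncreasingTimes S = ∀ i j → i < j → proj₂ (S i) < proj₂ (S j)

record Occurrence {m k : ℕ} (S : ℕ → Event m) (n : ℕ)
                  (e : Vec (Fin m) (suc k)) (τ : ℕ) : Set where
  field
    x          : Fin (suc k) → ℕ
    increasing : ∀ (i j : Fin (suc k)) → i Fin.< j → x i < x j
    inPrefix   : ∀ (i : Fin (suc k)) →
                 ∃ λ j → j < n × proj₂ (S j) ≡ x i × proj₁ (S j) ≡ lookup e i
    window     : x (fromℕ k) ≤ x Fin.zero + τ

open Occurrence public

firstT lastT : ∀ {m k S n e τ} → Occurrence {m} {k} S n e τ → ℕ
firstT o = x o Fin.zero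
lastT {k = k} o = x o (fromℕ k)

NonOverlapped : ∀ {m k S n e τ} → (o o' : Occurrence {m} {k} S n e τ) → Set
NonOverlapped o o' = lastT o < firstT o' ⊎ lastT o' < firstT o

NonOverlappedFamily : ∀ {m k} (S : ℕ → Event m) (n : ℕ)
                      (e : Vec (Fin m) (suc k)) (τ : ℕ) (c : ℕ) → Set
NonOverlappedFamily S n e τ c =
  Σ (Fin c → Occurrence S n e τ) λ occ →
    ∀ (a b : Fin c) → a ≢ b → NonOverlapped (occ a) (occ b)

IsFreq : ∀ {m k} (S : ℕ → Event m) (e : Vec (Fin m) (suc k)) (τ : ℕ)
         (n : ℕ) (c : ℕ) → Set
IsFreq S e τ n c =
  NonOverlappedFamily S n e τ c ×
  (∀ c' → NonOverlappedFamily S n e τ c' → c' ≤ c)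

-- lists L_1 … L_k (index j : Fin (suc k) is L_{toℕ j + 1}), ℓ, counter c
record State (k : ℕ) : Set where
  constructor ⟨_,_,_⟩
  field
    lists : Vec (List ℕ) (suc k)
    ell   : ℕ
    count : ℕ

open State public

initState : ∀ k → State k
initState k = ⟨ Vec.replicate (suc k) [] , 1 , 0 ⟩

isEmpty : List ℕ → Bool
isEmpty []      = true
isEmpty (_ ∷ _) = false

-- smallest 1-based index of an empty list, or (length + 1) if none
firstEmpty : ∀ {n} → Vec (List ℕ) n → ℕ
firstEmpty []       = 1
firstEmpty (L ∷ Ls) = if isEmpty L then 1 else suc (firstEmpty Ls)

-- largest 1-based index of a non-empty list, or 0 if all are empty
lastNonEmpty : ∀ {n} → Vec (List ℕ) n → ℕ
lastNonEmpty []       = 0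
lastNonEmpty (L ∷ Ls) with lastNonEmpty Ls
... | zero  = if isEmpty L then 0 else 1
... | suc r = suc (suc r)

appendAndExpire : (τ t : ℕ) → List ℕ → List ℕ
appendAndExpire τ t L with L ++ [ t ]
... | []       = []
... | (h ∷ hs) = if τ + h <ᵇ t then hs else h ∷ hs

listUpdate : ∀ {m k} (e : Vec (Fin m) (suc k)) (τ : ℕ) →
             State k → Event m → State k
listUpdate {k = k} e τ ⟨ Ls , ℓ , c ⟩ (s , t) =
  let Ls' = tabulate λ (j : Fin (suc k)) →
              if (toℕ j <ᵇ ℓ) ∧ does (lookup e j Fin.≟ s)   -- j+1 ≤ min(ℓ,k)
              then appendAndExpire τ t (lookup Ls j)
              else lookup Ls j
  in ⟨ Ls' , firstEmpty Ls' , c ⟩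

maxM : Maybe ℕ → ℕ → Maybe ℕ
maxM nothing  y = just y
maxM (just a) y = just (if a <ᵇ y then y else a)

largestBelow : List ℕ → ℕ → Maybe ℕ
largestBelow []      u = nothing
largestBelow (x ∷ L) u =
  if x <ᵇ u then maxM (largestBelow L u) x else largestBelow L u

-- the chosen timestamps t_1 … t_k : t_k = L_k[1], t_i = largest entry of
-- L_i smaller than t_{i+1}.  `nothing` means "undefined" (no such entry).
chosen : ∀ {n} → Vec (List ℕ) (suc n) → Vec (Maybe ℕ) (suc n)
chosen (L ∷ [])       = List.head L ∷ []
chosen (L ∷ L' ∷ Ls) with chosen (L' ∷ Ls)
... | r@(nothing ∷ _) = nothing ∷ r
... | r@(just u ∷ _)  = largestBelow L u ∷ r

removeLeq : Maybe ℕ → List ℕ → List ℕ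
removeLeq nothing  L = L
removeLeq (just a) L = filter (λ y → a Data.Nat.<? y) L

-- for i = 2, …, k-1 (sequentially) remove from L_i all entries ≤ L_{i-1}[1]
cleanupRest : ∀ {n} → List ℕ → Vec (List ℕ) n → Vec (List ℕ) n
cleanupRest p []            = []
cleanupRest p (L ∷ [])      = L ∷ []
cleanupRest p (L ∷ L' ∷ Ls) =
  let L'' = removeLeq (List.head p) L in L'' ∷ cleanupRest L'' (L' ∷ Ls)

cleanup : ∀ {n} → Vec (List ℕ) n → Vec (List ℕ) n
cleanup []       = []
cleanup (L ∷ Ls) = L ∷ cleanupRest L Ls

validates : (τ : ℕ) → Maybe ℕ → Maybe ℕ → Bool
validates τ (just t₁) (just tₖ) = tₖ ≤ᵇ t₁ + τ
validates τ _         _         = false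

validateEliminate : ∀ {k} (τ : ℕ) → State k → State k
validateEliminate {k} τ ⟨ Ls , ℓ , c ⟩ =
  let ts = chosen Ls in
  if validates τ (Vec.head ts) (Vec.last ts)
  then ⟨ Vec.replicate (suc k) [] , 1 , suc c ⟩
  else
    let Ls₁ = zipWith removeLeq ts Ls
        Ls₂ = cleanup Ls₁
    in ⟨ Ls₂ , suc (lastNonEmpty Ls₂) , c ⟩

step : ∀ {m k} (e : Vec (Fin m) (suc k)) (τ : ℕ) → State k → Event m → State k
step e τ st ev =
  let st' = listUpdate e τ st ev in
  if isEmpty (Vec.last (lists st')) then st' else validateEliminate τ st'

run : ∀ {m k} (e : Vec (Fin m) (suc k)) (τ : ℕ) (S : ℕ → Event m) → ℕ → State k
run {k = k} e τ S zero    = initState k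
run         e τ S (suc n) = step e τ (run e τ S n) (S n)

module Submission where

-- Lists and episode positions are indexed from 0, so the episode is
-- φ_0, …, φ_k and L_k is the last list.  Let r ≤ n be the number of events seen
-- when the lists were last emptied.  After n events:
--   (i)   S(r) contains `count` pairwise non-overlapped occurrences, and every
--         shorter prefix S(n''), n'' < r, was left with a smaller counter;
--   (ii)  the lists are sorted, L_k is empty, and L_i only holds timestamps of
--         events of type φ_i among the events r, …, n-1;
--   (iii) no occurrence of e^τ lies entirely within the events r, …, n-1;
--   (iv)  every partial occurrence within r, …, n-1 that can still be
--         completed in time is dominated by a chain through the lists.
-- (i) gives the lower bound.  For the upper bound, in a family of c'+1
-- non-overlapped occurrences the one ending last starts at an event i₀ after
-- all others have ended; by (iii) i₀ < r, so by (i) and induction on c' we get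
-- c' ≤ count(S(i₀)) < count(S(n)).

open import Defs
open import Data.Nat using (ℕ; zero; suc; _+_; _≤_; _<_; _<ᵇ_; z≤n; s≤s; _<?_; _≤?_; s≤s⁻¹)
open import Data.Nat.Properties
open import Data.Bool using (true; false; T; if_then_else_; _∧_)
open import Data.Fin as Fin using (Fin; toℕ; fromℕ; fromℕ<)
import Data.Fin.Properties as FinP
open import Data.List as List using (List; []; _∷_; _++_; [_]; filter)
open import Data.List.Membership.Propositional using (_∈_)
open import Data.List.Membership.Propositional.Properties using (∈-filter⁺; ∈-filter⁻; ∈-++⁻; ∈-++⁺ˡ; ∈-++⁺ʳ)
open import Data.List.Relation.Unary.Any using (here; there)
open import Data.Maybe using (Maybe; just; nothing; fromMaybe)
open import Data.Maybe.Properties using (just-injective)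
open import Data.Vec as Vec using (Vec; []; _∷_; lookup; zipWith)
import Data.Vec.Properties as VecP
open import Data.Product using (Σ; ∃; _×_; _,_; proj₁; proj₂)
open import Data.Sum as Sum using (_⊎_; inj₁; inj₂; [_,_]′)
open import Data.Empty using (⊥; ⊥-elim)
open import Data.Unit using (⊤; tt)
open import Relation.Nullary using (¬_; yes; no; does)
open import Relation.Unary using (Decidable)
open import Relation.Binary.PropositionalEquality using (_≡_; _≢_; refl; sym; trans; cong; subst; subst₂; cong₂)
open import Relation.Binary.Definitions using (tri<; tri≈; tri>)

T-true : ∀ {b} → b ≡ true → T b
T-true eq = subst T (sym eq) tt

T-false : ∀ {b} → b ≡ false → ¬ T b
T-false eq = subst T eq

-- Positional access to a vector with a default value beyond its end; indexing
-- by ℕ instead of Fin lets the invariant talk about "list i" arithmetically.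
nth : ∀ {A : Set} {n} → A → Vec A n → ℕ → A
nth d []       i       = d
nth d (x ∷ xs) zero    = x
nth d (x ∷ xs) (suc i) = nth d xs i

nthL : ∀ {n} → Vec (List ℕ) n → ℕ → List ℕ
nthL = nth []

nthM : ∀ {n} → Vec (Maybe ℕ) n → ℕ → Maybe ℕ
nthM = nth nothing

nth-lookup : ∀ {A : Set} {n} (d : A) (xs : Vec A n) (f : Fin n) → nth d xs (toℕ f) ≡ lookup xs f
nth-lookup d (x ∷ xs) Fin.zero    = refl
nth-lookup d (x ∷ xs) (Fin.suc f) = nth-lookup d xs f

nth-head : ∀ {A : Set} {n} (d : A) (xs : Vec A (suc n)) → Vec.head xs ≡ nth d xs 0
nth-head d (x ∷ xs) = refl

nth-last : ∀ {A : Set} {n} (d : A) (xs : Vec A (suc n)) → Vec.last xs ≡ nth d xs n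
nth-last d (x ∷ [])     = refl
nth-last d (x ∷ y ∷ xs) = nth-last d (y ∷ xs)

nth-beyond : ∀ {A : Set} {n} (d : A) (xs : Vec A n) i → n ≤ i → nth d xs i ≡ d
nth-beyond d []       i       _       = refl
nth-beyond d (x ∷ xs) (suc i) (s≤s p) = nth-beyond d xs i p

nth-zipWith : ∀ {A B C : Set} {n} (f : A → B → C) da db → (xs : Vec A n) (ys : Vec B n) (i : ℕ) →
              nth (f da db) (zipWith f xs ys) i ≡ f (nth da xs i) (nth db ys i)
nth-zipWith f da db []       []       i       = refl
nth-zipWith f da db (x ∷ xs) (y ∷ ys) zero    = refl
nth-zipWith f da db (x ∷ xs) (y ∷ ys) (suc i) = nth-zipWith f da db xs ys i

nth-replicate : ∀ {A : Set} {n} (d : A) i → nth d (Vec.replicate n d) i ≡ d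
nth-replicate {n = zero}  d i       = refl
nth-replicate {n = suc n} d zero    = refl
nth-replicate {n = suc n} d (suc i) = nth-replicate {n = n} d i

byFin : ∀ {n} (P : ℕ → Set) → (∀ (f : Fin n) → P (toℕ f)) → ∀ i → i < n → P i
byFin P h i p = subst P (FinP.toℕ-fromℕ< p) (h (fromℕ< p))

Sorted : List ℕ → Set
Sorted []       = ⊤
Sorted (x ∷ xs) = (∀ {y} → y ∈ xs → x < y) × Sorted xs

sorted-filter : ∀ {P : ℕ → Set} (P? : Decidable P) L → Sorted L → Sorted (filter P? L)
sorted-filter P? []       _ = tt
sorted-filter P? (x ∷ xs) (h , s) with does (P? x)
... | true  = (λ y∈ → h (proj₁ (∈-filter⁻ P? {xs = xs} y∈))) , sorted-filter P? xs s
... | false = sorted-filter P? xs s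

sorted-head : ∀ L {h y} → Sorted L → List.head L ≡ just h → y ∈ L → h ≤ y
sorted-head (x ∷ L) s         refl (here refl) = ≤-refl
sorted-head (x ∷ L) (hs , _) refl (there y∈)  = <⇒≤ (hs y∈)

sorted-snoc : ∀ L t → Sorted L → (∀ {y} → y ∈ L → y < t) → Sorted (L ++ [ t ])
sorted-snoc []      t s        lt = (λ ()) , tt
sorted-snoc (x ∷ L) t (hs , s) lt =
  (λ y∈ → [ hs , (λ { (here refl) → lt (here refl) }) ]′ (∈-++⁻ L y∈)) ,
  sorted-snoc L t s (λ y∈ → lt (there y∈))

head-∈ : ∀ (L : List ℕ) {h} → List.head L ≡ just h → h ∈ L
head-∈ (x ∷ L) refl = here refl

∈⇒nonEmpty : ∀ {L : List ℕ} {y} → y ∈ L → L ≢ []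
∈⇒nonEmpty () refl

isEmpty-[] : ∀ {L : List ℕ} → isEmpty L ≡ true → L ≡ []
isEmpty-[] {[]} _ = refl

removeLeq-⊆ : ∀ a L {y} → y ∈ removeLeq a L → y ∈ L
removeLeq-⊆ nothing  L y∈ = y∈
removeLeq-⊆ (just a) L y∈ = proj₁ (∈-filter⁻ (a <?_) {xs = L} y∈)

removeLeq-keeps : ∀ a L {y} → y ∈ L → (∀ v → a ≡ just v → v < y) → y ∈ removeLeq a L
removeLeq-keeps nothing  L y∈ h = y∈
removeLeq-keeps (just a) L y∈ h = ∈-filter⁺ (a <?_) y∈ (h a refl)

removeLeq-sorted : ∀ a L → Sorted L → Sorted (removeLeq a L)
removeLeq-sorted nothing  L s = s
removeLeq-sorted (just a) L s = sorted-filter (a <?_) L s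

removeLeq-all : ∀ v L → (∀ {y} → y ∈ L → y ≤ v) → removeLeq (just v) L ≡ []
removeLeq-all v []      h = refl
removeLeq-all v (x ∷ L) h with v <ᵇ x in eq
... | true  = ⊥-elim (<⇒≱ (<ᵇ⇒< v x (T-true eq)) (h (here refl)))
... | false = removeLeq-all v L (λ y∈ → h (there y∈))

expire : ℕ → ℕ → List ℕ → List ℕ
expire τ t []       = []
expire τ t (h ∷ hs) = if τ + h <ᵇ t then hs else h ∷ hs

appendAndExpire-≡ : ∀ τ t L → appendAndExpire τ t L ≡ expire τ t (L ++ [ t ])
appendAndExpire-≡ τ t L with L ++ [ t ]
... | []     = refl
... | h ∷ hs = refl

expire-⊆ : ∀ τ t M {y} → y ∈ expire τ t M → y ∈ M
expire-⊆ τ t (h ∷ hs) y∈ with τ + h <ᵇ t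
... | true  = there y∈
... | false = y∈

expire-keeps : ∀ τ t M {y} → y ∈ M → t ≤ τ + y → y ∈ expire τ t M
expire-keeps τ t (h ∷ hs) (here refl) le with τ + h <ᵇ t in eq
... | true  = ⊥-elim (<⇒≱ (<ᵇ⇒< (τ + h) t (T-true eq)) le)
... | false = here refl
expire-keeps τ t (h ∷ hs) (there y∈) le with τ + h <ᵇ t
... | true  = y∈
... | false = there y∈

expire-sorted : ∀ τ t M → Sorted M → Sorted (expire τ t M)
expire-sorted τ t []       s = tt
expire-sorted τ t (h ∷ hs) s with τ + h <ᵇ t
... | true  = proj₂ s
... | false = s

appendAndExpire-⊆ : ∀ τ t L {y} → y ∈ appendAndExpire τ t L → y ∈ L ⊎ y ≡ t
appendAndExpire-⊆ τ t L {y} y∈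
  with ∈-++⁻ L (expire-⊆ τ t (L ++ [ t ]) (subst (y ∈_) (appendAndExpire-≡ τ t L) y∈))
... | inj₁ p        = inj₁ p
... | inj₂ (here p)   = inj₂ p

appendAndExpire-keeps : ∀ τ t L {y} → y ∈ L → t ≤ τ + y → y ∈ appendAndExpire τ t L
appendAndExpire-keeps τ t L y∈ le =
  subst (_ ∈_) (sym (appendAndExpire-≡ τ t L)) (expire-keeps τ t (L ++ [ t ]) (∈-++⁺ˡ y∈) le)

appendAndExpire-new : ∀ τ t L → t ∈ appendAndExpire τ t L
appendAndExpire-new τ t L =
  subst (t ∈_) (sym (appendAndExpire-≡ τ t L))
        (expire-keeps τ t (L ++ [ t ]) (∈-++⁺ʳ L (here refl)) (m≤n+m t τ))

appendAndExpire-sorted : ∀ τ t L → Sorted L → (∀ {y} → y ∈ L → y < t) → Sorted (appendAndExpire τ t L)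
appendAndExpire-sorted τ t L s lt =
  subst Sorted (sym (appendAndExpire-≡ τ t L)) (expire-sorted τ t (L ++ [ t ]) (sorted-snoc L t s lt))

largestBelow-sound : ∀ L u {w} → largestBelow L u ≡ just w → w ∈ L × w < u
largestBelow-sound (x ∷ L) u eq with x <ᵇ u in xu
... | false = let (w∈ , w<u) = largestBelow-sound L u eq in there w∈ , w<u
... | true with largestBelow L u in lu
...   | nothing with refl ← eq = here refl , <ᵇ⇒< x u (T-true xu)
...   | just a with a <ᵇ x
...     | true  with refl ← eq = here refl , <ᵇ⇒< x u (T-true xu)
...     | false with refl ← eq = let (a∈ , a<u) = largestBelow-sound L u lu in there a∈ , a<u

largestBelow-maximal : ∀ L u {y} → y ∈ L → y < u → ∃ λ w → largestBelow L u ≡ just w × y ≤ w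
largestBelow-maximal (x ∷ L) u y∈ yu with x <ᵇ u in xu
largestBelow-maximal (x ∷ L) u (here refl) yu | false = ⊥-elim (T-false xu (<⇒<ᵇ yu))
largestBelow-maximal (x ∷ L) u (there y∈)  yu | false = largestBelow-maximal L u y∈ yu
largestBelow-maximal (x ∷ L) u y∈ yu | true with largestBelow L u in lu
largestBelow-maximal (x ∷ L) u (here refl) yu | true | nothing = x , refl , ≤-refl
largestBelow-maximal (x ∷ L) u (there y∈)  yu | true | nothing
  with largestBelow-maximal L u y∈ yu
... | w , eq , _ with () ← trans (sym lu) eq
largestBelow-maximal (x ∷ L) u y∈ yu | true | just a with a <ᵇ x in ax
largestBelow-maximal (x ∷ L) u (here refl) yu | true | just a | true = x , refl , ≤-refl
largestBelow-maximal (x ∷ L) u (there y∈)  yu | true | just a | true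
  with largestBelow-maximal L u y∈ yu
... | w , eq , le with refl ← trans (sym lu) eq = x , refl , <⇒≤ (≤-<-trans le (<ᵇ⇒< a x (T-true ax)))
largestBelow-maximal (x ∷ L) u (here refl) yu | true | just a | false = a , refl , ≮⇒≥ (λ a<x → T-false ax (<⇒<ᵇ a<x))
largestBelow-maximal (x ∷ L) u (there y∈)  yu | true | just a | false
  with largestBelow-maximal L u y∈ yu
... | w , eq , le with refl ← trans (sym lu) eq = a , refl , le

chosen-top : ∀ {n} (Ls : Vec (List ℕ) (suc n)) → nthM (chosen Ls) n ≡ List.head (nthL Ls n)
chosen-top (L ∷ [])      = refl
chosen-top (L ∷ L' ∷ Ls) with chosen (L' ∷ Ls) | chosen-top (L' ∷ Ls)
... | nothing ∷ r | ih = ih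
... | just u  ∷ r | ih = ih

chosen-tail : ∀ {n} L L' (Ls : Vec (List ℕ) n) i →
              nthM (chosen (L ∷ L' ∷ Ls)) (suc i) ≡ nthM (chosen (L' ∷ Ls)) i
chosen-tail L L' Ls i with chosen (L' ∷ Ls)
... | nothing ∷ r = refl
... | just u  ∷ r = refl

chosen-step : ∀ {n} (Ls : Vec (List ℕ) (suc n)) i {v} → i < n → nthM (chosen Ls) (suc i) ≡ just v →
              nthM (chosen Ls) i ≡ largestBelow (nthL Ls i) v
chosen-step (L ∷ L' ∷ Ls) zero p h with chosen (L' ∷ Ls)
... | nothing ∷ r with () ← h
... | just u  ∷ r with refl ← h = refl
chosen-step (L ∷ L' ∷ Ls) (suc i) (s≤s p) h
  rewrite chosen-tail L L' Ls (suc i) | chosen-tail L L' Ls i = chosen-step (L' ∷ Ls) i p h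

chosen-undefined : ∀ {n} (Ls : Vec (List ℕ) (suc n)) i → i < n → nthM (chosen Ls) (suc i) ≡ nothing →
                   nthM (chosen Ls) i ≡ nothing
chosen-undefined (L ∷ L' ∷ Ls) zero p h with chosen (L' ∷ Ls)
... | nothing ∷ r = refl
... | just u  ∷ r with () ← h
chosen-undefined (L ∷ L' ∷ Ls) (suc i) (s≤s p) h
  rewrite chosen-tail L L' Ls (suc i) | chosen-tail L L' Ls i = chosen-undefined (L' ∷ Ls) i p h

chosen-defined : ∀ {n} (Ls : Vec (List ℕ) (suc n)) {w} → nthM (chosen Ls) 0 ≡ just w →
                 ∀ i → i ≤ n → ∃ λ v → nthM (chosen Ls) i ≡ just v
chosen-defined Ls h zero    _ = _ , h
chosen-defined Ls h (suc i) p with nthM (chosen Ls) (suc i) in eq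
... | just v  = v , refl
... | nothing with chosen-defined Ls h i (<⇒≤ p)
...   | v , eq' with () ← trans (sym (chosen-undefined Ls i p eq)) eq'

Increasing : ℕ → (ℕ → ℕ) → Set
Increasing j y = ∀ i → i < j → y i < y (suc i)

increasing-≤ : ∀ {y j} → Increasing j y → ∀ a b → a ≤ b → b ≤ j → y a ≤ y b
increasing-≤ {y} {j} inc a b ab bj with m≤n⇒m<n∨m≡n ab
... | inj₂ refl = ≤-refl
... | inj₁ a<b with b
...   | suc b' = ≤-trans (increasing-≤ inc a b' (s≤s⁻¹ a<b) (≤-trans (n≤1+n b') bj)) (<⇒≤ (inc b' bj))

increasing-< : ∀ {y j} → Increasing j y → ∀ a b → a < b → b ≤ j → y a < y b
increasing-< inc a (suc b) (s≤s ab) bj = ≤-<-trans (increasing-≤ inc a b ab (≤-trans (n≤1+n b) bj)) (inc b bj)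

Chain : ∀ {n} → Vec (List ℕ) n → ℕ → (ℕ → ℕ) → Set
Chain Ls j y = (∀ i → i ≤ j → y i ∈ nthL Ls i) × Increasing j y

chain-prefix : ∀ {n} {Ls : Vec (List ℕ) n} {j j' y} → j ≤ j' → Chain Ls j' y → Chain Ls j y
chain-prefix jj' (mem , inc) = (λ i p → mem i (≤-trans p jj')) , (λ i p → inc i (<-≤-trans p jj'))

chain-tail : ∀ {n L} {Ls : Vec (List ℕ) n} {j y} → Chain (L ∷ Ls) (suc j) y → Chain Ls j (λ i → y (suc i))
chain-tail (mem , inc) = (λ i p → mem (suc i) (s≤s p)) , (λ i p → inc (suc i) (s≤s p))

AllSorted : ∀ {n} → Vec (List ℕ) n → Set
AllSorted Ls = ∀ i → Sorted (nthL Ls i)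

chosenValue : ∀ {n} → Vec (List ℕ) (suc n) → ℕ → ℕ
chosenValue Ls i = fromMaybe 0 (nthM (chosen Ls) i)

chosen-just : ∀ {n} (Ls : Vec (List ℕ) (suc n)) {w} → nthM (chosen Ls) 0 ≡ just w →
              ∀ i → i ≤ n → nthM (chosen Ls) i ≡ just (chosenValue Ls i)
chosen-just Ls h i p with chosen-defined Ls h i p
... | v , eq rewrite eq = refl

chosen-chain : ∀ {n} (Ls : Vec (List ℕ) (suc n)) {w} → nthM (chosen Ls) 0 ≡ just w →
               Chain Ls n (chosenValue Ls)
chosen-chain {n} Ls h = mem , (λ i p → proj₂ (below i p))
  where
  below : ∀ i → i < n → chosenValue Ls i ∈ nthL Ls i × chosenValue Ls i < chosenValue Ls (suc i)
  below i p = largestBelow-sound (nthL Ls i) _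
                (trans (sym (chosen-step Ls i p (chosen-just Ls h (suc i) p))) (chosen-just Ls h i (<⇒≤ p)))
  mem : ∀ i → i ≤ n → chosenValue Ls i ∈ nthL Ls i
  mem i p with m≤n⇒m<n∨m≡n p
  ... | inj₁ q    = proj₁ (below i q)
  ... | inj₂ refl = head-∈ (nthL Ls n) (trans (sym (chosen-top Ls)) (chosen-just Ls h n ≤-refl))

-- Greedy domination: if a chain y₀ < ⋯ < y_i lies below the chosen t_i, then
-- t_1 is defined and y₀ ≤ t_1, because each t_i is the largest possible pick.
chosen-dominates : ∀ {n} (Ls : Vec (List ℕ) (suc n)) i (y : ℕ → ℕ) {v} → Chain Ls i y → i ≤ n →
                   nthM (chosen Ls) i ≡ just v → y i ≤ v →
                   ∃ λ w → nthM (chosen Ls) 0 ≡ just w × y 0 ≤ w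
chosen-dominates Ls zero    y ch p eq le = _ , eq , le
chosen-dominates Ls (suc i) y {v} ch@(mem , inc) p eq le
  with largestBelow-maximal (nthL Ls i) v (mem i (n≤1+n i)) (<-≤-trans (inc i ≤-refl) le)
... | w , eq' , le' =
  chosen-dominates Ls i y (chain-prefix {Ls = Ls} (n≤1+n i) ch) (<⇒≤ p) (trans (chosen-step Ls i p eq) eq') le'

-- A chain
-- through sorted lists survives it: its entry in L_i exceeds its entry in
-- L_{i-1}, which is at least the head of L_{i-1}.
HeadBelow : List ℕ → ℕ → Set
HeadBelow p v = ∀ h → List.head p ≡ just h → h < v

cleanupRest-keeps : ∀ {n} p (Ls : Vec (List ℕ) n) j y → HeadBelow p (y 0) → AllSorted Ls →
                    Chain Ls j y → Chain (cleanupRest p Ls) j y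
cleanupRest-keeps p []            j        y hb s ch = ch
cleanupRest-keeps p (L ∷ [])      j        y hb s ch = ch
cleanupRest-keeps p (L ∷ L' ∷ Ls) zero     y hb s (mem , inc) =
  (λ { zero _ → removeLeq-keeps (List.head p) L (mem 0 z≤n) hb }) , inc
cleanupRest-keeps p (L ∷ L' ∷ Ls) (suc j') y hb s ch@(mem , inc) = mem' , inc
  where
  L'' : List ℕ
  L'' = removeLeq (List.head p) L
  y₀∈ : y 0 ∈ L''
  y₀∈ = removeLeq-keeps (List.head p) L (mem 0 z≤n) hb
  hb' : HeadBelow L'' (y 1)
  hb' h eq = ≤-<-trans (sorted-head L'' (removeLeq-sorted (List.head p) L (s 0)) eq y₀∈) (inc 0 (s≤s z≤n))
  rest : Chain (cleanupRest L'' (L' ∷ Ls)) j' (λ i → y (suc i))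
  rest = cleanupRest-keeps L'' (L' ∷ Ls) j' (λ i → y (suc i)) hb' (λ i → s (suc i)) (chain-tail ch)
  mem' : ∀ i → i ≤ suc j' → y i ∈ nthL (L'' ∷ cleanupRest L'' (L' ∷ Ls)) i
  mem' zero    _  = y₀∈
  mem' (suc i) le = proj₁ rest i (s≤s⁻¹ le)

cleanup-keeps : ∀ {n} (Ls : Vec (List ℕ) n) j y → AllSorted Ls → Chain Ls j y → Chain (cleanup Ls) j y
cleanup-keeps []       j        y s ch = ch
cleanup-keeps (L ∷ Ls) zero     y s (mem , inc) = (λ { zero le → mem 0 le }) , inc
cleanup-keeps (L ∷ Ls) (suc j') y s ch@(mem , inc) = mem' , inc
  where
  rest : Chain (cleanupRest L Ls) j' (λ i → y (suc i))
  rest = cleanupRest-keeps L Ls j' (λ i → y (suc i))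
           (λ h eq → ≤-<-trans (sorted-head L (s 0) eq (mem 0 z≤n)) (inc 0 (s≤s z≤n)))
           (λ i → s (suc i)) (chain-tail ch)
  mem' : ∀ i → i ≤ suc j' → y i ∈ nthL (L ∷ cleanupRest L Ls) i
  mem' zero    le = mem 0 le
  mem' (suc i) le = proj₁ rest i (s≤s⁻¹ le)

cleanupRest-⊆ : ∀ {n} p (Ls : Vec (List ℕ) n) i {y} → y ∈ nthL (cleanupRest p Ls) i → y ∈ nthL Ls i
cleanupRest-⊆ p []            i       y∈ = y∈
cleanupRest-⊆ p (L ∷ [])      i       y∈ = y∈
cleanupRest-⊆ p (L ∷ L' ∷ Ls) zero    y∈ = removeLeq-⊆ (List.head p) L y∈
cleanupRest-⊆ p (L ∷ L' ∷ Ls) (suc i) y∈ = cleanupRest-⊆ (removeLeq (List.head p) L) (L' ∷ Ls) i y∈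

cleanup-⊆ : ∀ {n} (Ls : Vec (List ℕ) n) i {y} → y ∈ nthL (cleanup Ls) i → y ∈ nthL Ls i
cleanup-⊆ []       i       y∈ = y∈
cleanup-⊆ (L ∷ Ls) zero    y∈ = y∈
cleanup-⊆ (L ∷ Ls) (suc i) y∈ = cleanupRest-⊆ L Ls i y∈

cleanupRest-sorted : ∀ {n} p (Ls : Vec (List ℕ) n) → AllSorted Ls → AllSorted (cleanupRest p Ls)
cleanupRest-sorted p []            s = s
cleanupRest-sorted p (L ∷ [])      s = s
cleanupRest-sorted p (L ∷ L' ∷ Ls) s zero    = removeLeq-sorted (List.head p) L (s 0)
cleanupRest-sorted p (L ∷ L' ∷ Ls) s (suc i) =
  cleanupRest-sorted (removeLeq (List.head p) L) (L' ∷ Ls) (λ i → s (suc i)) i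

cleanup-sorted : ∀ {n} (Ls : Vec (List ℕ) n) → AllSorted Ls → AllSorted (cleanup Ls)
cleanup-sorted []       s         = s
cleanup-sorted (L ∷ Ls) s zero    = s 0
cleanup-sorted (L ∷ Ls) s (suc i) = cleanupRest-sorted L Ls (λ i → s (suc i)) i

cleanupRest-last : ∀ {n} p (Ls : Vec (List ℕ) (suc n)) → nthL (cleanupRest p Ls) n ≡ nthL Ls n
cleanupRest-last p (L ∷ [])      = refl
cleanupRest-last p (L ∷ L' ∷ Ls) = cleanupRest-last (removeLeq (List.head p) L) (L' ∷ Ls)

cleanup-last : ∀ {n} (Ls : Vec (List ℕ) (suc n)) → nthL (cleanup Ls) n ≡ nthL Ls n
cleanup-last (L ∷ [])      = refl
cleanup-last (L ∷ L' ∷ Ls) = cleanupRest-last L (L' ∷ Ls)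

firstEmpty-above : ∀ {n} (Ls : Vec (List ℕ) n) j → j ≤ n → (∀ i → i < j → nthL Ls i ≢ []) → j < firstEmpty Ls
firstEmpty-above []              zero    _       _ = s≤s z≤n
firstEmpty-above ([] ∷ Ls)       zero    _       _ = s≤s z≤n
firstEmpty-above ((x ∷ L) ∷ Ls)  zero    _       _ = s≤s z≤n
firstEmpty-above ([] ∷ Ls)       (suc j) _       h = ⊥-elim (h 0 (s≤s z≤n) refl)
firstEmpty-above ((x ∷ L) ∷ Ls)  (suc j) (s≤s p) h =
  s≤s (firstEmpty-above Ls j p (λ i le → h (suc i) (s≤s le)))

lastNonEmpty-above : ∀ {n} (Ls : Vec (List ℕ) n) i → nthL Ls i ≢ [] → suc i ≤ lastNonEmpty Ls
lastNonEmpty-above []       i ne = ⊥-elim (ne refl)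
lastNonEmpty-above (L ∷ Ls) i ne with lastNonEmpty Ls | lastNonEmpty-above Ls
lastNonEmpty-above ([] ∷ Ls)      zero    ne | zero  | ih = ⊥-elim (ne refl)
lastNonEmpty-above ((x ∷ L) ∷ Ls) zero    ne | zero  | ih = s≤s z≤n
lastNonEmpty-above (L ∷ Ls)       (suc i) ne | zero  | ih with () ← ih i ne
lastNonEmpty-above (L ∷ Ls)       zero    ne | suc r | ih = s≤s z≤n
lastNonEmpty-above (L ∷ Ls)       (suc i) ne | suc r | ih = s≤s (ih i ne)

snocAt : (ℕ → ℕ) → ℕ → ℕ → ℕ → ℕ
snocAt y j t i with i ≤? j
... | yes _ = y i
... | no  _ = t

snocAt-below : ∀ y j t i → i ≤ j → snocAt y j t i ≡ y i
snocAt-below y j t i p with i ≤? j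
... | yes _ = refl
... | no ¬p = ⊥-elim (¬p p)

snocAt-top : ∀ y j t → snocAt y j t (suc j) ≡ t
snocAt-top y j t with suc j ≤? j
... | yes p = ⊥-elim (1+n≰n p)
... | no  _ = refl

clampFin : (k i : ℕ) → Fin (suc k)
clampFin k       zero    = Fin.zero
clampFin zero    (suc i) = Fin.zero
clampFin (suc k) (suc i) = Fin.suc (clampFin k i)

toℕ-clampFin : ∀ k i → i ≤ k → toℕ (clampFin k i) ≡ i
toℕ-clampFin k       zero    _       = refl
toℕ-clampFin (suc k) (suc i) (s≤s p) = cong suc (toℕ-clampFin k i p)

clampFin-top : ∀ k → clampFin k k ≡ fromℕ k
clampFin-top k = FinP.toℕ-injective (trans (toℕ-clampFin k k ≤-refl) (sym (FinP.toℕ-fromℕ k)))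

argmax : ∀ c (h : Fin (suc c) → ℕ) → Σ (Fin (suc c)) λ a → ∀ b → h b ≤ h a
argmax zero    h = Fin.zero , λ { Fin.zero → ≤-refl }
argmax (suc c) h with argmax c (λ b → h (Fin.suc b))
... | a' , p with h Fin.zero ≤? h (Fin.suc a')
...   | yes q = Fin.suc a' , λ { Fin.zero → q ; (Fin.suc b) → p b }
...   | no  q = Fin.zero , λ { Fin.zero → ≤-refl ; (Fin.suc b) → ≤-trans (p b) (<⇒≤ (≰⇒> q)) }

chain-snoc : ∀ {n} {Ls : Vec (List ℕ) n} {j y t} → Chain Ls j y → t ∈ nthL Ls (suc j) → y j < t →
             Chain Ls (suc j) (snocAt y j t)
chain-snoc {Ls = Ls} {j} {y} {t} (mem , inc) t∈ yj<t = mem' , inc'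
  where
  mem' : ∀ i → i ≤ suc j → snocAt y j t i ∈ nthL Ls i
  mem' i p with m≤n⇒m<n∨m≡n p
  ... | inj₁ q    = subst (_∈ nthL Ls i) (sym (snocAt-below y j t i (s≤s⁻¹ q))) (mem i (s≤s⁻¹ q))
  ... | inj₂ refl = subst (_∈ nthL Ls (suc j)) (sym (snocAt-top y j t)) t∈
  inc' : Increasing (suc j) (snocAt y j t)
  inc' i p with m≤n⇒m<n∨m≡n (s≤s⁻¹ p)
  ... | inj₁ q    = subst₂ _<_ (sym (snocAt-below y j t i (<⇒≤ q))) (sym (snocAt-below y j t (suc i) q)) (inc i q)
  ... | inj₂ refl = subst₂ _<_ (sym (snocAt-below y j t j ≤-refl)) (sym (snocAt-top y j t)) yj<t

validates-true : ∀ τ {a b} → validates τ a b ≡ true → ∃ λ w → ∃ λ h → a ≡ just w × b ≡ just h × h ≤ w + τ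
validates-true τ {just w} {just h} eq = w , h , refl , refl , ≤ᵇ⇒≤ h (w + τ) (T-true eq)

validates-false : ∀ τ {w h} → validates τ (just w) (just h) ≡ false → ¬ h ≤ w + τ
validates-false τ {w} {h} eq le = T-false eq (≤⇒≤ᵇ le)

module Correctness (m : ℕ) (S : ℕ → Event m) (inc : StrictlyIncreasingTimes S)
                   (k : ℕ) (e : Vec (Fin m) (suc k)) (τ : ℕ) where

  ts : ℕ → ℕ
  ts i = proj₂ (S i)

  ty : ℕ → Fin m
  ty i = proj₁ (S i)

  φ : ℕ → Fin m
  φ = nth (Vec.head e) e

  counter : ℕ → ℕ
  counter n = count (run e τ S n)

  ts-reflects-< : ∀ {i j} → ts i < ts j → i < j
  ts-reflects-< {i} {j} p with <-cmp i j
  ... | tri< a _ _    = a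
  ... | tri≈ _ refl _ = ⊥-elim (<-irrefl refl p)
  ... | tri> _ _ c    = ⊥-elim (<-asym p (inc j i c))

  ts-reflects-≤ : ∀ {i j} → ts i ≤ ts j → i ≤ j
  ts-reflects-≤ {i} {j} p with <-cmp i j
  ... | tri< a _ _    = <⇒≤ a
  ... | tri≈ _ refl _ = ≤-refl
  ... | tri> _ _ c    = ⊥-elim (<⇒≱ (inc j i c) p)

  ts-injective : ∀ {i j} → ts i ≡ ts j → i ≡ j
  ts-injective p = ≤-antisym (ts-reflects-≤ (≤-reflexive p)) (ts-reflects-≤ (≤-reflexive (sym p)))

  Ev : ℕ → ℕ → ℕ → ℕ → Set
  Ev r n i y = Σ ℕ λ idx → r ≤ idx × idx < n × ts idx ≡ y × ty idx ≡ φ i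

  Partial : ℕ → ℕ → ℕ → (ℕ → ℕ) → Set
  Partial r n j x = Increasing j x × (∀ i → i ≤ j → Ev r n i (x i))

  Occ : ℕ → Set
  Occ n = Occurrence S n e τ

  firstIndex : ∀ {n} → Occ n → ℕ
  firstIndex o = proj₁ (inPrefix o Fin.zero)

  NoOcc : ℕ → ℕ → Set
  NoOcc r n = ∀ x → Partial r n k x → x k ≤ x 0 + τ → ⊥

  Ev-weaken : ∀ {r n n' i y} → n ≤ n' → Ev r n i y → Ev r n' i y
  Ev-weaken p (idx , a , b , c , d) = idx , a , <-≤-trans b p , c , d

  Ev-restrict : ∀ {r n i y} → Ev r (suc n) i y → y < ts n → Ev r n i y
  Ev-restrict {n = n} (idx , a , b , c , d) lt with m<1+n⇒m<n∨m≡n b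
  ... | inj₁ q    = idx , a , q , c , d
  ... | inj₂ refl = ⊥-elim (<-irrefl (sym c) lt)

  partial-restrict : ∀ {r n j x} → Partial r (suc n) j x → (∀ i → i ≤ j → x i < ts n) → Partial r n j x
  partial-restrict (ord , ev) h = ord , λ i p → Ev-restrict (ev i p) (h i p)

  partial-before : ∀ {r n j x idx} → Partial r (suc n) j x → ts idx ≡ x j → idx < n → Partial r n j x
  partial-before {j = j} P@(ord , _) c idx<n =
    partial-restrict P (λ i p → ≤-<-trans (subst (_ ≤_) (sym c) (increasing-≤ ord i j p ≤-refl)) (inc _ _ idx<n))

  occ-within : ∀ {n} (o : Occ n) n' → (∀ f → proj₁ (inPrefix o f) < n') → Occ n'
  occ-within o n' h = record
    { x          = x o
    ; increasing = increasing o
    ; inPrefix   = λ f → let (j , _ , a , b) = inPrefix o f in j , h f , a , b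
    ; window     = window o }

  occ-≤ : ∀ {n} (o : Occ n) f g → toℕ f ≤ toℕ g → x o f ≤ x o g
  occ-≤ o f g p with m≤n⇒m<n∨m≡n p
  ... | inj₁ q = <⇒≤ (increasing o f g q)
  ... | inj₂ q with refl ← FinP.toℕ-injective q = ≤-refl

  occ→partial : ∀ {n} r (o : Occ n) → r ≤ firstIndex o →
                Partial r n k (λ i → x o (clampFin k i)) × x o (clampFin k k) ≤ x o (clampFin k 0) + τ
  occ→partial {n} r o r≤ = (ord , ev) , subst (λ f → x o f ≤ x o Fin.zero + τ) (sym (clampFin-top k)) (window o)
    where
    ord : Increasing k (λ i → x o (clampFin k i))
    ord i p = increasing o _ _
      (subst₂ _<_ (sym (toℕ-clampFin k i (<⇒≤ p))) (sym (toℕ-clampFin k (suc i) p)) (n<1+n i))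
    ev : ∀ i → i ≤ k → Ev r n i (x o (clampFin k i))
    ev i p with inPrefix o (clampFin k i) | inPrefix o Fin.zero
    ... | (idx , lt , eqt , eqs) | (idx₀ , _ , eqt₀ , _) =
      idx , ≤-trans r≤ (ts-reflects-≤ (subst₂ _≤_ (sym eqt₀) (sym eqt) (occ-≤ o Fin.zero (clampFin k i) z≤n))) ,
      lt , eqt , trans eqs (trans (sym (nth-lookup (Vec.head e) e (clampFin k i))) (cong φ (toℕ-clampFin k i p)))

  partial→occ : ∀ {r n} (z : ℕ → ℕ) → Partial r n k z → z k ≤ z 0 + τ → Occ n
  partial→occ {r} {n} z (ord , ev) w = record
    { x          = λ f → z (toℕ f)
    ; increasing = λ i j p → increasing-< ord (toℕ i) (toℕ j) p (s≤s⁻¹ (FinP.toℕ<n j))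
    ; inPrefix   = λ f → let (idx , _ , lt , a , b) = ev (toℕ f) (s≤s⁻¹ (FinP.toℕ<n f))
                         in idx , lt , a , trans b (nth-lookup (Vec.head e) e f)
    ; window     = subst (λ q → z q ≤ z 0 + τ) (sym (FinP.toℕ-fromℕ k)) w }

  extendFamily : ∀ {r n c} → r ≤ n → NonOverlappedFamily S r e τ c →
                 (o : Occ n) → r ≤ firstIndex o → NonOverlappedFamily S n e τ (suc c)
  extendFamily {r} {n} {c} r≤n (F , noF) o r≤o = F' , noF'
    where
    lift : Occ r → Occ n
    lift o' = occ-within o' n (λ f → <-≤-trans (proj₁ (proj₂ (inPrefix o' f))) r≤n)
    before : ∀ (o' : Occ r) → lastT o' < firstT o
    before o' with inPrefix o' (fromℕ k) | inPrefix o Fin.zero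
    ... | (j , j<r , eqt , _) | (_ , _ , eqt₀ , _) = subst₂ _<_ eqt eqt₀ (inc j _ (<-≤-trans j<r r≤o))
    F' : Fin (suc c) → Occ n
    F' Fin.zero    = o
    F' (Fin.suc a) = lift (F a)
    noF' : ∀ a b → a ≢ b → NonOverlapped (F' a) (F' b)
    noF' Fin.zero    Fin.zero    ne = ⊥-elim (ne refl)
    noF' Fin.zero    (Fin.suc b) ne = inj₂ (before (F b))
    noF' (Fin.suc a) Fin.zero    ne = inj₁ (before (F a))
    noF' (Fin.suc a) (Fin.suc b) ne = noF a b (λ eq → ne (cong Fin.suc eq))

  DominatedBy : Vec (List ℕ) (suc k) → ℕ → (ℕ → ℕ) → Set
  DominatedBy Ls j x = Σ (ℕ → ℕ) λ y → Chain Ls j y × x 0 ≤ y 0 × y j ≤ x j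

  -- Every partial occurrence among the events r, …, n-1 that may still be
  -- completed (some time u after all seen events is within τ of x₀) is dominated.
  Dominates : Vec (List ℕ) (suc k) → ℕ → ℕ → Set
  Dominates Ls r n = ∀ j → j < k → ∀ x → Partial r n j x → ∀ u → (∀ idx → idx < n → ts idx < u) →
                     u ≤ x 0 + τ → DominatedBy Ls j x

  -- The invariant after n events, with r the number of events seen when the
  -- lists were last emptied; fields are grouped as (i)–(iv) of the overview,
  -- plus the fact that ℓ lies beyond every initial run of non-empty lists.
  record Inv (n : ℕ) (st : State k) : Set where
    field
      r      : ℕ
      r≤n    : r ≤ n
      -- (i)
      below  : ∀ n'' → n'' < r → counter n'' < count st
      fam    : NonOverlappedFamily S r e τ (count st)
      -- (ii)
      sound  : ∀ i {y} → y ∈ nthL (lists st) i → Ev r n i y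
      sorted : AllSorted (lists st)
      lastE  : nthL (lists st) k ≡ []
      ellOK  : ∀ j → j ≤ k → (∀ i → i < j → nthL (lists st) i ≢ []) → j < ell st
      -- (iii)
      noOcc  : NoOcc r n
      -- (iv)
      chains : Dominates (lists st) r n

  emptyInv : ∀ n c → NonOverlappedFamily S n e τ c → (∀ n'' → n'' < n → counter n'' < c) →
             Inv n ⟨ Vec.replicate (suc k) [] , 1 , c ⟩
  emptyInv n c F bl = record
    { r = n ; r≤n = ≤-refl ; below = bl ; fam = F
    ; sound  = λ i y∈ → ⊥-elim (∈⇒nonEmpty y∈ (empty i))
    ; sorted = λ i → subst Sorted (sym (empty i)) tt
    ; lastE  = empty k
    ; ellOK  = λ { zero _ _ → s≤s z≤n ; (suc j) _ h → ⊥-elim (h 0 (s≤s z≤n) (empty 0)) }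
    ; noOcc  = λ x (_ , ev) _ → noEvent (ev 0 z≤n)
    ; chains = λ j _ x (_ , ev) _ _ _ → ⊥-elim (noEvent (ev 0 z≤n)) }
    where
    empty : ∀ i → nthL (Vec.replicate (suc k) []) i ≡ []
    empty i = nth-replicate {n = suc k} [] i
    noEvent : ∀ {i y} → ¬ Ev n n i y
    noEvent (_ , a , b , _) = <⇒≱ b a

  module Step (n : ℕ) (st : State k) (I : Inv n st)
              (mono : ∀ n'' → n'' ≤ n → counter n'' ≤ count st) where
    open Inv I

    s : Fin m
    s = ty n

    t : ℕ
    t = ts n

    Ls : Vec (List ℕ) (suc k)
    Ls = lists st

    ℓ : ℕ
    ℓ = ell st

    Ls' : Vec (List ℕ) (suc k)
    Ls' = lists (listUpdate e τ st (S n))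

    updated : Fin (suc k) → List ℕ
    updated f = if (toℕ f <ᵇ ℓ) ∧ does (lookup e f Fin.≟ s) then appendAndExpire τ t (lookup Ls f) else lookup Ls f

    updated-cases : ∀ f → (toℕ f < ℓ × lookup e f ≡ s × updated f ≡ appendAndExpire τ t (lookup Ls f)) ⊎
                          (updated f ≡ lookup Ls f × ¬ (toℕ f < ℓ × lookup e f ≡ s))
    updated-cases f with toℕ f <ᵇ ℓ in f<ℓ | lookup e f Fin.≟ s
    ... | true  | yes p = inj₁ (<ᵇ⇒< _ _ (T-true f<ℓ) , p , refl)
    ... | true  | no ne = inj₂ (refl , λ (_ , q) → ne q)
    ... | false | _     = inj₂ (refl , λ (p , _) → T-false f<ℓ (<⇒<ᵇ p))

    φ-lookup : ∀ f → φ (toℕ f) ≡ lookup e f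
    φ-lookup f = nth-lookup (Vec.head e) e f

    nthL-updated : ∀ f → nthL Ls' (toℕ f) ≡ updated f
    nthL-updated f = trans (nth-lookup [] Ls' f) (VecP.lookup∘tabulate updated f)

    updateCases : ∀ f → (toℕ f < ℓ × φ (toℕ f) ≡ s × nthL Ls' (toℕ f) ≡ appendAndExpire τ t (nthL Ls (toℕ f))) ⊎
                        (nthL Ls' (toℕ f) ≡ nthL Ls (toℕ f) × ¬ (toℕ f < ℓ × φ (toℕ f) ≡ s))
    updateCases f with updated-cases f
    ... | inj₁ (p , q , eq) = inj₁ (p , trans (φ-lookup f) q ,
                              trans (nthL-updated f) (trans eq (cong (appendAndExpire τ t) (sym (nth-lookup [] Ls f)))))
    ... | inj₂ (eq , ne)    = inj₂ (trans (nthL-updated f) (trans eq (sym (nth-lookup [] Ls f))) ,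
                              λ (p , q) → ne (p , trans (sym (φ-lookup f)) q))

    update-origin : ∀ i {y} → y ∈ nthL Ls' i → y ∈ nthL Ls i ⊎ (y ≡ t × φ i ≡ s)
    update-origin i {y} y∈ with i <? suc k
    ... | no  q = ⊥-elim (∈⇒nonEmpty y∈ (nth-beyond [] Ls' i (≮⇒≥ q)))
    ... | yes q = byFin (λ i → y ∈ nthL Ls' i → y ∈ nthL Ls i ⊎ (y ≡ t × φ i ≡ s)) origin i q y∈
      where
      origin : ∀ f → y ∈ nthL Ls' (toℕ f) → y ∈ nthL Ls (toℕ f) ⊎ (y ≡ t × φ (toℕ f) ≡ s)
      origin f y∈ with updateCases f
      ... | inj₁ (_ , φs , eq) = Sum.map₂ (_, φs) (appendAndExpire-⊆ τ t _ (subst (y ∈_) eq y∈))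
      ... | inj₂ (eq , _)      = inj₁ (subst (y ∈_) eq y∈)

    update-keeps : ∀ i {y} → y ∈ nthL Ls i → t ≤ τ + y → y ∈ nthL Ls' i
    update-keeps i {y} y∈ le with i <? suc k
    ... | no  q = ⊥-elim (∈⇒nonEmpty y∈ (nth-beyond [] Ls i (≮⇒≥ q)))
    ... | yes q = byFin (λ i → y ∈ nthL Ls i → y ∈ nthL Ls' i) keeps i q y∈
      where
      keeps : ∀ f → y ∈ nthL Ls (toℕ f) → y ∈ nthL Ls' (toℕ f)
      keeps f y∈ with updateCases f
      ... | inj₁ (_ , _ , eq) = subst (y ∈_) (sym eq) (appendAndExpire-keeps τ t _ y∈ le)
      ... | inj₂ (eq , _)     = subst (y ∈_) (sym eq) y∈

    update-appends : ∀ i → i ≤ k → i < ℓ → φ i ≡ s → t ∈ nthL Ls' i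
    update-appends i i≤k = byFin (λ i → i < ℓ → φ i ≡ s → t ∈ nthL Ls' i) appends i (s≤s i≤k)
      where
      appends : ∀ f → toℕ f < ℓ → φ (toℕ f) ≡ s → t ∈ nthL Ls' (toℕ f)
      appends f p q with updateCases f
      ... | inj₁ (_ , _ , eq) = subst (t ∈_) (sym eq) (appendAndExpire-new τ t (nthL Ls (toℕ f)))
      ... | inj₂ (_ , ne)     = ⊥-elim (ne (p , q))

    old<t : ∀ i {y} → y ∈ nthL Ls i → y < t
    old<t i y∈ with sound i y∈
    ... | (idx , _ , lt , refl , _) = inc idx n lt

    sound' : ∀ i {y} → y ∈ nthL Ls' i → Ev r (suc n) i y
    sound' i y∈ with update-origin i y∈
    ... | inj₁ old          = Ev-weaken (n≤1+n n) (sound i old)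
    ... | inj₂ (refl , φs)  = n , r≤n , ≤-refl , refl , sym φs

    sorted' : AllSorted Ls'
    sorted' i with i <? suc k
    ... | no  q = subst Sorted (sym (nth-beyond [] Ls' i (≮⇒≥ q))) tt
    ... | yes q = byFin (λ i → Sorted (nthL Ls' i)) sortedAt i q
      where
      sortedAt : ∀ f → Sorted (nthL Ls' (toℕ f))
      sortedAt f with updateCases f
      ... | inj₁ (_ , _ , eq) = subst Sorted (sym eq) (appendAndExpire-sorted τ t _ (sorted (toℕ f)) (old<t (toℕ f)))
      ... | inj₂ (eq , _)     = subst Sorted (sym eq) (sorted (toℕ f))

    event-at-t : ∀ {r' i y} → Ev r' (suc n) i y → y ≡ t → φ i ≡ s
    event-at-t (idx , _ , _ , c , d) eq with refl ← ts-injective (trans c eq) = sym d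

    update-keeps-chain : ∀ j y → Chain Ls j y → t ≤ y 0 + τ → Chain Ls' j y
    update-keeps-chain j y (mem , ord) le = (λ i p → update-keeps i (mem i p) (t≤τ+y i p)) , ord
      where
      t≤τ+y : ∀ i → i ≤ j → t ≤ τ + y i
      t≤τ+y i p = ≤-trans le (≤-trans (+-monoˡ-≤ τ (increasing-≤ ord 0 i z≤n p)) (≤-reflexive (+-comm (y i) τ)))

    -- A partial occurrence ending at the new event is dominated by the new lists:
    -- extend the chain dominating its first j events by t.
    dominate-ending-at-t : ∀ j → j ≤ k → ∀ x → Partial r (suc n) j x → x j ≡ t → t ≤ x 0 + τ → DominatedBy Ls' j x
    dominate-ending-at-t zero _ x (_ , ev) xj _ =
      (λ _ → t) , ((λ { zero _ → update-appends 0 z≤n ℓ>0 (event-at-t (ev 0 z≤n) xj) }) , (λ _ ())) ,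
      ≤-reflexive xj , ≤-reflexive (sym xj)
      where
      ℓ>0 : 0 < ℓ
      ℓ>0 = ellOK 0 z≤n (λ _ ())
    dominate-ending-at-t (suc j) j<k x P@(ord , ev) xj tle =
      snocAt y j t , chain-snoc {Ls = Ls'} kept t∈ (≤-<-trans yj≤xj xj<t) ,
      subst (x 0 ≤_) (sym (snocAt-below y j t 0 z≤n)) x₀≤y₀ , ≤-reflexive (trans (snocAt-top y j t) (sym xj))
      where
      xi<t : ∀ i → i ≤ j → x i < t
      xi<t i q = subst (x i <_) xj (increasing-< ord i (suc j) (s≤s q) ≤-refl)
      xj<t : x j < t
      xj<t = xi<t j ≤-refl
      P' : Partial r n j x
      P' = partial-restrict ((λ i q → ord i (m<n⇒m<1+n q)) , (λ i q → ev i (m≤n⇒m≤1+n q))) xi<t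
      dom : DominatedBy Ls j x
      dom = chains j j<k x P' t (λ idx q → inc idx n q) tle
      y : ℕ → ℕ
      y = proj₁ dom
      ch : Chain Ls j y
      ch = proj₁ (proj₂ dom)
      x₀≤y₀ : x 0 ≤ y 0
      x₀≤y₀ = proj₁ (proj₂ (proj₂ dom))
      yj≤xj : y j ≤ x j
      yj≤xj = proj₂ (proj₂ (proj₂ dom))
      kept : Chain Ls' j y
      kept = update-keeps-chain j y ch (≤-trans tle (+-monoˡ-≤ τ x₀≤y₀))
      t∈ : t ∈ nthL Ls' (suc j)
      t∈ = update-appends (suc j) j<k (ellOK (suc j) j<k (λ i q → ∈⇒nonEmpty (proj₁ ch i (s≤s⁻¹ q))))
                          (event-at-t (ev (suc j) ≤-refl) xj)

    chains' : Dominates Ls' r (suc n)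
    chains' j j<k x P u hu ux with proj₂ P j ≤-refl
    ... | (idx , _ , lt , c , _) with m<1+n⇒m<n∨m≡n lt
    ...   | inj₂ refl = dominate-ending-at-t j (<⇒≤ j<k) x P (sym c) (≤-trans (<⇒≤ (hu n ≤-refl)) ux)
    ...   | inj₁ idx<n with chains j j<k x (partial-before P c idx<n) u (λ idx' p → hu idx' (m<n⇒m<1+n p)) ux
    ...     | (y , ch , x₀≤y₀ , yj≤xj) =
              y , update-keeps-chain j y ch (≤-trans (<⇒≤ (hu n ≤-refl)) (≤-trans ux (+-monoˡ-≤ τ x₀≤y₀))) ,
              x₀≤y₀ , yj≤xj

    -- New occurrences must end at the new event; they are excluded once no
    -- chain of the new lists ending at t starts within τ of t.
    noOcc' : (∀ y → Chain Ls' k y → y k ≤ t → t ≤ y 0 + τ → ⊥) → NoOcc r (suc n)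
    noOcc' noChain x P w with proj₂ P k ≤-refl
    ... | (idx , _ , lt , c , _) with m<1+n⇒m<n∨m≡n lt
    ...   | inj₁ idx<n = noOcc x (partial-before P c idx<n) w
    ...   | inj₂ refl with dominate-ending-at-t k ≤-refl x P (sym c) (subst (_≤ x 0 + τ) (sym c) w)
    ...     | (y , ch , x₀≤y₀ , yk≤xk) =
              noChain y ch (subst (y k ≤_) (sym c) yk≤xk) (≤-trans (subst (_≤ x 0 + τ) (sym c) w) (+-monoˡ-≤ τ x₀≤y₀))

    Lk-empty-after : isEmpty (Vec.last Ls') ≡ true → nthL Ls' k ≡ []
    Lk-empty-after eA = isEmpty-[] (trans (cong isEmpty (sym (nth-last [] Ls'))) eA)

    inv-skip : isEmpty (Vec.last Ls') ≡ true → Inv (suc n) (listUpdate e τ st (S n))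
    inv-skip eA = record
      { r = r ; r≤n = m≤n⇒m≤1+n r≤n ; below = below ; fam = fam
      ; sound  = sound'
      ; sorted = sorted'
      ; lastE  = Lk-empty-after eA
      ; ellOK  = λ j j≤k h → firstEmpty-above Ls' j (m≤n⇒m≤1+n j≤k) h
      ; noOcc  = noOcc' (λ y (mem , _) _ _ → ∈⇒nonEmpty (mem k ≤-refl) (Lk-empty-after eA))
      ; chains = chains' }

    c : Vec (Maybe ℕ) (suc k)
    c = chosen Ls'

    -- L_k was empty before ListUpdate, so now it holds only t, and t_k = t.
    Lk-only-t : ∀ {y} → y ∈ nthL Ls' k → y ≡ t
    Lk-only-t y∈ with update-origin k y∈
    ... | inj₁ old     = ⊥-elim (∈⇒nonEmpty old lastE)
    ... | inj₂ (eq , _) = eq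

    tₖ≡t : isEmpty (Vec.last Ls') ≡ false → nthM c k ≡ just t
    tₖ≡t eA with nthL Ls' k in eq | trans (cong isEmpty (sym (nth-last [] Ls'))) eA
    ... | h ∷ _ | _ = trans (chosen-top Ls') (trans (cong List.head eq)
                             (cong just (Lk-only-t (subst (h ∈_) (sym eq) (here refl)))))

    validation-≡ : validates τ (Vec.head c) (Vec.last c) ≡ validates τ (nthM c 0) (nthM c k)
    validation-≡ = cong₂ (validates τ) (nth-head nothing c) (nth-last nothing c)

    -- Case 2: validation succeeds; the chosen t_1 < ⋯ < t_k is an occurrence
    -- after all counted ones, and the lists are emptied.
    inv-validated : validates τ (Vec.head c) (Vec.last c) ≡ true →
                    Inv (suc n) ⟨ Vec.replicate (suc k) [] , 1 , suc (count st) ⟩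
    inv-validated eV with validates-true τ (trans (sym validation-≡) eV)
    ... | w , h , c₀ , cₖ , h≤w+τ =
      emptyInv (suc n) (suc (count st)) (extendFamily (m≤n⇒m≤1+n r≤n) fam occ (proj₁ (proj₂ (proj₂ P 0 z≤n))))
               (λ n'' p → s≤s (mono n'' (s≤s⁻¹ p)))
      where
      z : ℕ → ℕ
      z = chosenValue Ls'
      P : Partial r (suc n) k z
      P = let (mem , ord) = chosen-chain Ls' c₀ in ord , λ i p → sound' i (mem i p)
      win : z k ≤ z 0 + τ
      win = subst₂ (λ a b → a ≤ b + τ) (just-injective (trans (sym cₖ) (chosen-just Ls' c₀ k ≤-refl)))
                   (just-injective (trans (sym c₀) (chosen-just Ls' c₀ 0 z≤n))) h≤w+τ
      occ : Occ (suc n)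
      occ = partial→occ z P win

    Ls₁ : Vec (List ℕ) (suc k)
    Ls₁ = zipWith removeLeq c Ls'

    Ls₂ : Vec (List ℕ) (suc k)
    Ls₂ = cleanup Ls₁

    nthL-Ls₁ : ∀ i → nthL Ls₁ i ≡ removeLeq (nthM c i) (nthL Ls' i)
    nthL-Ls₁ i = nth-zipWith removeLeq nothing [] c Ls' i

    sorted₁ : AllSorted Ls₁
    sorted₁ i = subst Sorted (sym (nthL-Ls₁ i)) (removeLeq-sorted (nthM c i) (nthL Ls' i) (sorted' i))

    -- Case 3: validation fails; elimination loses no chain that can still be completed.
    module Rejected (eA : isEmpty (Vec.last Ls') ≡ false)
                    (eV : validates τ (Vec.head c) (Vec.last c) ≡ false) where

      -- t_1, whenever defined, is more than τ older than t.
      rejected : ∀ w → nthM c 0 ≡ just w → ¬ t ≤ w + τ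
      rejected w c₀ = validates-false τ (trans (cong₂ (validates τ) (sym c₀) (sym (tₖ≡t eA)))
                                               (trans (sym validation-≡) eV))

      -- Hence, by greedy domination, a chain starting within τ of t lies
      -- strictly above the chosen values.
      chain-above-chosen : ∀ j y → Chain Ls' j y → j ≤ k → t ≤ y 0 + τ →
                           ∀ i → i ≤ j → ∀ v → nthM c i ≡ just v → v < y i
      chain-above-chosen j y ch j≤k le i i≤j v eq with v <? y i
      ... | yes q = q
      ... | no  q with chosen-dominates Ls' i y (chain-prefix {Ls = Ls'} i≤j ch) (≤-trans i≤j j≤k) eq (≮⇒≥ q)
      ...   | w , c₀ , y₀≤w = ⊥-elim (rejected w c₀ (≤-trans le (+-monoˡ-≤ τ y₀≤w)))

      eliminate-keeps-chain : ∀ j y → Chain Ls' j y → j ≤ k → t ≤ y 0 + τ → Chain Ls₂ j y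
      eliminate-keeps-chain j y ch@(mem , ord) j≤k le = cleanup-keeps Ls₁ j y sorted₁ (mem₁ , ord)
        where
        mem₁ : ∀ i → i ≤ j → y i ∈ nthL Ls₁ i
        mem₁ i p = subst (_ ∈_) (sym (nthL-Ls₁ i))
                     (removeLeq-keeps (nthM c i) (nthL Ls' i) (mem i p) (chain-above-chosen j y ch j≤k le i p))

      inv-rejected : Inv (suc n) ⟨ Ls₂ , suc (lastNonEmpty Ls₂) , count st ⟩
      inv-rejected = record
        { r = r ; r≤n = m≤n⇒m≤1+n r≤n ; below = below ; fam = fam
        ; sound  = λ i y∈ → sound' i (removeLeq-⊆ (nthM c i) (nthL Ls' i) (subst (_ ∈_) (nthL-Ls₁ i) (cleanup-⊆ Ls₁ i y∈)))
        ; sorted = cleanup-sorted Ls₁ sorted₁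
        ; lastE  = trans (cleanup-last Ls₁) (trans (nthL-Ls₁ k)
                     (subst (λ a → removeLeq a (nthL Ls' k) ≡ []) (sym (tₖ≡t eA))
                            (removeLeq-all t (nthL Ls' k) (λ y∈ → ≤-reflexive (Lk-only-t y∈)))))
        ; ellOK  = ell₂
        ; noOcc  = noOcc' (λ y ch yk≤t le → <⇒≱ (chain-above-chosen k y ch ≤-refl le k ≤-refl t (tₖ≡t eA)) yk≤t)
        ; chains = chains₂ }
        where
        ell₂ : ∀ j → j ≤ k → (∀ i → i < j → nthL Ls₂ i ≢ []) → j < suc (lastNonEmpty Ls₂)
        ell₂ zero    _ _ = s≤s z≤n
        ell₂ (suc j) _ h = s≤s (lastNonEmpty-above Ls₂ j (h j ≤-refl))
        chains₂ : Dominates Ls₂ r (suc n)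
        chains₂ j j<k x P u hu ux with chains' j j<k x P u hu ux
        ... | (y , ch , x₀≤y₀ , yj≤xj) =
          y , eliminate-keeps-chain j y ch (<⇒≤ j<k) (≤-trans (<⇒≤ (hu n ≤-refl)) (≤-trans ux (+-monoˡ-≤ τ x₀≤y₀))) ,
          x₀≤y₀ , yj≤xj

    stepInv : Inv (suc n) (step e τ st (S n))
    stepInv with isEmpty (Vec.last (lists (listUpdate e τ st (S n)))) in eA
    ... | true  = inv-skip eA
    ... | false with validates τ (Vec.head (chosen (lists (listUpdate e τ st (S n)))))
                                 (Vec.last (chosen (lists (listUpdate e τ st (S n))))) in eV
    ...   | true  = inv-validated eV
    ...   | false = Rejected.inv-rejected eA eV

  count-step : ∀ (st : State k) ev → count (step e τ st ev) ≡ count st ⊎ count (step e τ st ev) ≡ suc (count st)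
  count-step st ev with isEmpty (Vec.last (lists (listUpdate e τ st ev)))
  ... | true  = inj₁ refl
  ... | false with validates τ (Vec.head (chosen (lists (listUpdate e τ st ev))))
                               (Vec.last (chosen (lists (listUpdate e τ st ev))))
  ...   | true  = inj₂ refl
  ...   | false = inj₁ refl

  counter-mono : ∀ n n'' → n'' ≤ n → counter n'' ≤ counter n
  counter-mono zero    zero _ = ≤-refl
  counter-mono (suc n) n'' p with m≤n⇒m<n∨m≡n p
  ... | inj₂ refl = ≤-refl
  ... | inj₁ q with count-step (run e τ S n) (S n)
  ...   | inj₁ eq = subst (counter n'' ≤_) (sym eq) (counter-mono n n'' (s≤s⁻¹ q))
  ...   | inj₂ eq = subst (counter n'' ≤_) (sym eq) (m≤n⇒m≤1+n (counter-mono n n'' (s≤s⁻¹ q)))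

  invariant : ∀ n → Inv n (run e τ S n)
  invariant zero    = emptyInv 0 0 ((λ ()) , λ ()) (λ _ ())
  invariant (suc n) = Step.stepInv n (run e τ S n) (invariant n) (counter-mono n)

  -- If S(n) contains an occurrence starting at event i₀, then every prefix
  -- S(n''), n'' ≤ i₀, has a smaller counter: by (iii) the occurrence starts
  -- before r, and (i) applies.
  counter-grows : ∀ n (o : Occ n) n'' → n'' ≤ firstIndex o → counter n'' < counter n
  counter-grows n o n'' n''≤i₀ with n'' <? Inv.r (invariant n)
  ... | yes q = Inv.below (invariant n) n'' q
  ... | no  q = let (P , w) = occ→partial (Inv.r (invariant n)) o (≤-trans (≮⇒≥ q) n''≤i₀)
                in ⊥-elim (Inv.noOcc (invariant n) _ P w)

  -- Removing the occurrence that ends last leaves a family within the events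
  -- before its first event.
  dropLast : ∀ c' n → (F : NonOverlappedFamily S n e τ (suc c')) →
             Σ (Fin (suc c')) λ a₀ → NonOverlappedFamily S (firstIndex (proj₁ F a₀)) e τ c'
  dropLast c' n (F , noF) = a₀ , F' , noF'
    where
    lastEnd : Σ (Fin (suc c')) λ a → ∀ b → lastT (F b) ≤ lastT (F a)
    lastEnd = argmax c' (λ a → lastT (F a))
    a₀ : Fin (suc c')
    a₀ = proj₁ lastEnd
    o : Occ n
    o = F a₀
    endsBefore : ∀ b → b ≢ a₀ → lastT (F b) < firstT o
    endsBefore b ne with noF b a₀ ne
    ... | inj₁ q = q
    ... | inj₂ q = ⊥-elim (<⇒≱ q (≤-trans (occ-≤ (F b) Fin.zero (fromℕ k) z≤n) (proj₂ lastEnd b)))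
    F' : Fin c' → Occ (firstIndex o)
    F' b = occ-within (F (Fin.punchIn a₀ b)) (firstIndex o) within
      where
      within : ∀ f → proj₁ (inPrefix (F (Fin.punchIn a₀ b)) f) < firstIndex o
      within f with inPrefix (F (Fin.punchIn a₀ b)) f | inPrefix o Fin.zero
      ... | (j , _ , eqt , _) | (_ , _ , eqt₀ , _) =
        ts-reflects-< (subst₂ _<_ (sym eqt) (sym eqt₀)
          (≤-<-trans (occ-≤ (F (Fin.punchIn a₀ b)) f (fromℕ k) (FinP.≤fromℕ f))
                     (endsBefore (Fin.punchIn a₀ b) (FinP.punchInᵢ≢i a₀ b))))
    noF' : ∀ a b → a ≢ b → NonOverlapped (F' a) (F' b)
    noF' a b ne = noF (Fin.punchIn a₀ a) (Fin.punchIn a₀ b) (λ eq → ne (FinP.punchIn-injective a₀ a b eq))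

  frequency-bound : ∀ c' n → NonOverlappedFamily S n e τ c' → c' ≤ counter n
  frequency-bound zero     n _ = z≤n
  frequency-bound (suc c') n F with dropLast c' n F
  ... | a₀ , F' = ≤-<-trans (frequency-bound c' _ F') (counter-grows n (proj₁ F a₀) _ ≤-refl)

  -- Lower bound: the family of (i) lies in S(r) ⊆ S(n).
  frequency-attained : ∀ n → NonOverlappedFamily S n e τ (counter n)
  frequency-attained n = (λ a → occ-within (F a) n (λ f → <-≤-trans (proj₁ (proj₂ (inPrefix (F a) f))) (Inv.r≤n I))) ,
                         proj₂ (Inv.fam I)
    where
    I : Inv n (run e τ S n)
    I = invariant n
    F : Fin (counter n) → Occ (Inv.r I)
    F = proj₁ (Inv.fam I)

theorem3 : (m : ℕ) (S : ℕ → Event m) → StrictlyIncreasingTimes S →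
           (k : ℕ) (e : Vec (Fin m) (suc k)) (τ : ℕ) → 0 < τ →
           ∀ n → 1 ≤ n → IsFreq S e τ n (count (run e τ S n))
theorem3 m S inc k e τ _ n _ =
  frequency-attained n , λ c' family → frequency-bound c' n family
  where open Correctness m S inc k e τ
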